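{- The sign pattern $\begin{bmatrix}-&+&-\\0&+&+\\+&0&-\end{bmatrix}$ requires algebraic positivity.
   Context: For a sign pattern $S$ (matrix with entries in $\{+,-,0\}$), $Q(S)$ is the set of real matrices $X$ with $\mathrm{sgn}(X_{ij})=S_{ij}$ for all $i,j$. A real square matrix $M$ is algebraically positive if there is a real polynomial $p$ with all entries of $p(M)$ positive. $S$ requires algebraic positivity if every $X\in Q(S)$ is algebraically positive. -}

module Defs where

open import Level using (0ℓ)
open import Data.Nat using (ℕ; zero; suc)
open import Data.Fin using (Fin; zero; suc; _≟_)
open import Data.List using (List; []; _∷_)
open import Data.Product using (Σ; ∃; _×_; _,_)
open import Data.Sum using (_⊎_)
open import Relation.Nullary using (¬_; yes; no)
open import Relation.Binary.PropositionalEquality using (_≡_)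
open import Relation.Binary.Structures using (IsStrictTotalOrder)
open import Algebra.Structures using (IsCommutativeRing)

-- The real numbers, given axiomatically as a complete ordered field
-- (unique up to isomorphism, so quantifying over all models is the same
-- as speaking about ℝ).
record RealField : Set₁ where
  infixl 6 _+_
  infixl 7 _*_
  infix 4 _<_ _≤_
  field
    Carrier : Set
    _+_ _*_ : Carrier → Carrier → Carrier
    -_      : Carrier → Carrier
    0# 1#   : Carrier
    _<_     : Carrier → Carrier → Set
    isCommutativeRing : IsCommutativeRing _≡_ _+_ _*_ -_ 0# 1#
    0≢1     : ¬ (0# ≡ 1#)
    inverse : ∀ x → ¬ (x ≡ 0#) → ∃ λ y → x * y ≡ 1#
    isStrictTotalOrder : IsStrictTotalOrder _≡_ _<_
    +-mono-< : ∀ {x y} z → x < y → x + z < y + z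
    *-pos    : ∀ {x y} → 0# < x → 0# < y → 0# < x * y

  _≤_ : Carrier → Carrier → Set
  x ≤ y = x < y ⊎ x ≡ y

  field
    complete : (P : Carrier → Set) → (∃ λ x → P x) →
               (∃ λ b → ∀ x → P x → x ≤ b) →
               ∃ λ s → (∀ x → P x → x ≤ s) × (∀ b → (∀ x → P x → x ≤ b) → s ≤ b)

data Sign : Set where
  ⊕ ⊖ ⊙ : Sign

SignPattern : ℕ → Set
SignPattern n = Fin n → Fin n → Sign

module _ (R : RealField) where
  open RealField R

  Matrix : ℕ → Set
  Matrix n = Fin n → Fin n → Carrier

  HasSign : Carrier → Sign → Set
  HasSign x ⊕ = 0# < x
  HasSign x ⊖ = x < 0#
  HasSign x ⊙ = x ≡ 0#

  InQ : ∀ {n} → SignPattern n → Matrix n → Set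
  InQ S X = ∀ i j → HasSign (X i j) (S i j)

  sumFin : ∀ n → (Fin n → Carrier) → Carrier
  sumFin zero    f = 0#
  sumFin (suc n) f = f zero + sumFin n (λ i → f (suc i))

  _⊗_ : ∀ {n} → Matrix n → Matrix n → Matrix n
  _⊗_ {n} A B i j = sumFin n (λ k → A i k * B k j)

  identity : ∀ {n} → Matrix n
  identity i j with i ≟ j
  ... | yes _ = 1#
  ... | no  _ = 0#

  -- Real polynomials as coefficient lists [a₀, a₁, …, a_d] (p(x) = Σ aₖ xᵏ);
  -- evaluation at a square matrix by Horner's scheme:
  -- p(M) = a₀ I + M (a₁ I + M (…)).
  evalPoly : ∀ {n} → List Carrier → Matrix n → Matrix n
  evalPoly []       M i j = 0#
  evalPoly (a ∷ as) M i j = a * identity i j + (M ⊗ evalPoly as M) i j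

  AlgebraicallyPositive : ∀ {n} → Matrix n → Set
  AlgebraicallyPositive M = ∃ λ (p : List Carrier) → ∀ i j → 0# < evalPoly p M i j

  RequiresAlgebraicPositivity : ∀ {n} → SignPattern n → Set
  RequiresAlgebraicPositivity S = ∀ X → InQ S X → AlgebraicallyPositive X

S16 : SignPattern 3
S16 zero zero = ⊖
S16 zero (suc zero) = ⊕
S16 zero (suc (suc zero)) = ⊖
S16 (suc zero) zero = ⊙
S16 (suc zero) (suc zero) = ⊕
S16 (suc zero) (suc (suc zero)) = ⊕
S16 (suc (suc zero)) zero = ⊕
S16 (suc (suc zero)) (suc zero) = ⊙
S16 (suc (suc zero)) (suc (suc zero)) = ⊖

-- Every X ∈ Q(S16) has the form
--     X = [[-a, b, -c], [0, d, e], [f, 0, -g]]   with a, …, g > 0.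
-- For the polynomial  p(t) = β + α t + 2c t²  with
--     α = 2c(a + g) + be,   β = 2c²f + 2acg + abe + gbe
-- a direct computation gives
--     p(X) = [[gbe,  b(2cg + be + 2cd),  cbe          ],
--             [2cef, β + αd + 2cd²,      e(2ca + be + 2cd)],
--             [fbe,  2cfb,               abe          ]],
-- whose entries are sums of products of a, …, g, hence positive.

module Submission where

open import Defs
open import Level using (0ℓ)
open import Data.Nat as ℕ using (ℕ; zero; suc)
open import Data.Fin using (Fin; zero; suc; _≟_; #_)
open import Data.List using (List; []; _∷_; map)
open import Data.Vec using (Vec; []; _∷_; lookup)
open import Data.Vec.Relation.Unary.All using (All; []; _∷_)
open import Data.Vec.Relation.Unary.All.Properties using (lookup⁺)
open import Data.Unit using (⊤)
open import Data.Empty using (⊥)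
open import Data.Product using (_×_; _,_)
open import Data.Product.Properties using (≡-dec)
open import Data.Maybe using (Maybe)
import Data.Maybe as Maybe
open import Relation.Nullary using (yes; no)
open import Relation.Nullary.Decidable using (dec⇒maybe)
open import Relation.Binary.PropositionalEquality
open import Relation.Binary.Structures using (IsStrictTotalOrder)
open import Algebra.Bundles using (CommutativeRing; RawRing)
open import Algebra.Structures using (IsCommutativeRing)
import Algebra.Properties.Ring as RingProperties
import Algebra.Properties.CommutativeSemigroup as CommutativeSemigroupProperties
import Algebra.Properties.Semiring.Mult as SemiringMultProperties
open import Algebra.Solver.Ring.AlmostCommutativeRing
  using (fromCommutativeRing; _-Raw-AlmostCommutative⟶_)
import Algebra.Solver.Ring as RingSolver

pattern 𝟘 = zero
pattern 𝟙 = suc zero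
pattern 𝟚 = suc (suc zero)

module _ (R : RealField) where
  open RealField R
  open IsCommutativeRing isCommutativeRing
    using (+-identityˡ; +-identityʳ; -‿inverseʳ)

  commutativeRing : CommutativeRing 0ℓ 0ℓ
  commutativeRing = record { isCommutativeRing = isCommutativeRing }

  open CommutativeRing commutativeRing
    using (_-_; ring; semiring; +-commutativeSemigroup)
  open RingProperties ring
    using (-0#≈0#; -‿involutive; -‿+-comm; ⁻¹-anti-homo‿-; x[y-z]≈xy-xz; [y-z]x≈yx-zx)
  open CommutativeSemigroupProperties +-commutativeSemigroup using (interchange)
  open SemiringMultProperties semiring using (×-homo-1; ×-homo-+; ×1-homo-*)
    renaming (_×_ to _·_)
  open ≡-Reasoning

  +-pos : ∀ {x y} → 0# < x → 0# < y → 0# < x + y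
  +-pos {x} {y} 0<x 0<y =
    IsStrictTotalOrder.trans isStrictTotalOrder 0<y
      (subst (_< x + y) (+-identityˡ y) (+-mono-< y 0<x))

  neg⇒-pos : ∀ {x} → x < 0# → 0# < - x
  neg⇒-pos {x} x<0 = subst₂ _<_ (-‿inverseʳ x) (+-identityˡ (- x)) (+-mono-< (- x) x<0)

  x-0≡x : ∀ x → x - 0# ≡ x
  x-0≡x x = trans (cong (x +_) -0#≈0#) (+-identityʳ x)

  diff-+ : ∀ a b c d → (a - b) + (c - d) ≡ (a + c) - (b + d)
  diff-+ a b c d = begin
    (a - b) + (c - d)      ≡⟨ interchange a (- b) c (- d) ⟩
    (a + c) + (- b + - d)  ≡⟨ cong ((a + c) +_) (-‿+-comm b d) ⟩
    (a + c) - (b + d)      ∎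

  diff-* : ∀ a b c d → (a - b) * (c - d) ≡ (a * c + b * d) - (a * d + b * c)
  diff-* a b c d = begin
    (a - b) * (c - d)                  ≡⟨ [y-z]x≈yx-zx (c - d) a b ⟩
    a * (c - d) - b * (c - d)          ≡⟨ cong₂ _-_ (x[y-z]≈xy-xz a c d) (x[y-z]≈xy-xz b c d) ⟩
    (a * c - a * d) - (b * c - b * d)  ≡⟨ cong ((a * c - a * d) +_) (⁻¹-anti-homo‿- (b * c) (b * d)) ⟩
    (a * c - a * d) + (b * d - b * c)  ≡⟨ diff-+ (a * c) (a * d) (b * d) (b * c) ⟩
    (a * c + b * d) - (a * d + b * c)  ∎

  diff-cancel : ∀ x a b → (x + a) - (x + b) ≡ a - b
  diff-cancel x a b = begin
    (x + a) - (x + b)   ≡⟨ diff-+ x x a b ⟨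
    (x - x) + (a - b)   ≡⟨ cong (_+ (a - b)) (-‿inverseʳ x) ⟩
    0# + (a - b)        ≡⟨ +-identityˡ (a - b) ⟩
    a - b               ∎

  -- Integers as pairs (m , n) standing for m − n, normalised so that one
  -- component is zero; then equal integers are equal pairs, which is what
  -- the solver needs to compare coefficients.

  Diff : Set
  Diff = ℕ × ℕ

  normalise : ℕ → ℕ → Diff
  normalise m       zero    = (m , zero)
  normalise zero    (suc n) = (zero , suc n)
  normalise (suc m) (suc n) = normalise m n

  _+ᶻ_ _*ᶻ_ : Diff → Diff → Diff
  (m , n) +ᶻ (m′ , n′) = normalise (m ℕ.+ m′) (n ℕ.+ n′)
  (m , n) *ᶻ (m′ , n′) = normalise (m ℕ.* m′ ℕ.+ n ℕ.* n′) (m ℕ.* n′ ℕ.+ n ℕ.* m′)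

  -ᶻ_ : Diff → Diff
  -ᶻ (m , n) = (n , m)

  diffRawRing : RawRing 0ℓ 0ℓ
  diffRawRing = record
    { Carrier = Diff ; _≈_ = _≡_ ; _+_ = _+ᶻ_ ; _*_ = _*ᶻ_ ; -_ = -ᶻ_
    ; 0# = (0 , 0) ; 1# = (1 , 0) }

  ⟨_⟩ : ℕ → Carrier
  ⟨ m ⟩ = m · 1#

  ⟦_⟧ᶻ : Diff → Carrier
  ⟦ m , n ⟧ᶻ = ⟨ m ⟩ - ⟨ n ⟩

  ⟦0⟧ᶻ : ⟦ 0 , 0 ⟧ᶻ ≡ 0#
  ⟦0⟧ᶻ = x-0≡x 0#

  ⟦1⟧ᶻ : ⟦ 1 , 0 ⟧ᶻ ≡ 1#
  ⟦1⟧ᶻ = trans (cong (_- 0#) (×-homo-1 1#)) (x-0≡x 1#)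

  normalise-sound : ∀ m n → ⟦ normalise m n ⟧ᶻ ≡ ⟦ m , n ⟧ᶻ
  normalise-sound m       zero    = refl
  normalise-sound zero    (suc n) = refl
  normalise-sound (suc m) (suc n) =
    trans (normalise-sound m n) (sym (diff-cancel 1# ⟨ m ⟩ ⟨ n ⟩))

  ⟨⟩-sum-of-products : ∀ m m′ n n′ → ⟨ m ℕ.* m′ ℕ.+ n ℕ.* n′ ⟩ ≡ ⟨ m ⟩ * ⟨ m′ ⟩ + ⟨ n ⟩ * ⟨ n′ ⟩
  ⟨⟩-sum-of-products m m′ n n′ =
    trans (×-homo-+ 1# (m ℕ.* m′) (n ℕ.* n′)) (cong₂ _+_ (×1-homo-* m m′) (×1-homo-* n n′))

  diffMorphism : diffRawRing -Raw-AlmostCommutative⟶ fromCommutativeRing commutativeRing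
  diffMorphism = record
    { ⟦_⟧    = ⟦_⟧ᶻ
    ; +-homo = λ { (m , n) (m′ , n′) → begin
        ⟦ normalise (m ℕ.+ m′) (n ℕ.+ n′) ⟧ᶻ        ≡⟨ normalise-sound (m ℕ.+ m′) (n ℕ.+ n′) ⟩
        ⟨ m ℕ.+ m′ ⟩ - ⟨ n ℕ.+ n′ ⟩                 ≡⟨ cong₂ _-_ (×-homo-+ 1# m m′) (×-homo-+ 1# n n′) ⟩
        (⟨ m ⟩ + ⟨ m′ ⟩) - (⟨ n ⟩ + ⟨ n′ ⟩)         ≡⟨ diff-+ ⟨ m ⟩ ⟨ n ⟩ ⟨ m′ ⟩ ⟨ n′ ⟩ ⟨
        ⟦ m , n ⟧ᶻ + ⟦ m′ , n′ ⟧ᶻ                   ∎ }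
    ; *-homo = λ { (m , n) (m′ , n′) → begin
        ⟦ (m , n) *ᶻ (m′ , n′) ⟧ᶻ
          ≡⟨ normalise-sound (m ℕ.* m′ ℕ.+ n ℕ.* n′) (m ℕ.* n′ ℕ.+ n ℕ.* m′) ⟩
        ⟨ m ℕ.* m′ ℕ.+ n ℕ.* n′ ⟩ - ⟨ m ℕ.* n′ ℕ.+ n ℕ.* m′ ⟩
          ≡⟨ cong₂ _-_ (⟨⟩-sum-of-products m m′ n n′) (⟨⟩-sum-of-products m n′ n m′) ⟩
        (⟨ m ⟩ * ⟨ m′ ⟩ + ⟨ n ⟩ * ⟨ n′ ⟩) - (⟨ m ⟩ * ⟨ n′ ⟩ + ⟨ n ⟩ * ⟨ m′ ⟩)
          ≡⟨ diff-* ⟨ m ⟩ ⟨ n ⟩ ⟨ m′ ⟩ ⟨ n′ ⟩ ⟨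
        ⟦ m , n ⟧ᶻ * ⟦ m′ , n′ ⟧ᶻ ∎ }
    ; -‿homo = λ { (m , n) → sym (⁻¹-anti-homo‿- ⟨ m ⟩ ⟨ n ⟩) }
    ; 0-homo = ⟦0⟧ᶻ
    ; 1-homo = ⟦1⟧ᶻ
    }

  -- Syntactically equal coefficients have equal values; normal forms make
  -- this sufficient for the solver.
  _≟ᶻ_ : ∀ x y → Maybe (⟦ x ⟧ᶻ ≡ ⟦ y ⟧ᶻ)
  x ≟ᶻ y = Maybe.map (cong ⟦_⟧ᶻ) (dec⇒maybe (≡-dec ℕ._≟_ ℕ._≟_ x y))

  open RingSolver diffRawRing (fromCommutativeRing commutativeRing) diffMorphism _≟ᶻ_
    using (Polynomial; op; [+]; [*]; var; con; _:+_; _:*_; :-_; ⟦_⟧; ⟦_⟧↓; prove)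

  SymMatrix : ℕ → ℕ → Set
  SymMatrix v n = Fin n → Fin n → Polynomial v

  sumᴾ : ∀ {v} n → (Fin n → Polynomial v) → Polynomial v
  sumᴾ zero    h = con (0 , 0)
  sumᴾ (suc n) h = h zero :+ sumᴾ n (λ k → h (suc k))

  _⊗ᴾ_ : ∀ {v n} → SymMatrix v n → SymMatrix v n → SymMatrix v n
  _⊗ᴾ_ {n = n} A B i j = sumᴾ n (λ k → A i k :* B k j)

  identityᴾ : ∀ {v n} → SymMatrix v n
  identityᴾ i j with i ≟ j
  ... | yes _ = con (1 , 0)
  ... | no  _ = con (0 , 0)

  evalPolyᴾ : ∀ {v n} → List (Polynomial v) → SymMatrix v n → SymMatrix v n
  evalPolyᴾ []       M i j = con (0 , 0)
  evalPolyᴾ (q ∷ qs) M i j = q :* identityᴾ i j :+ (M ⊗ᴾ evalPolyᴾ qs M) i j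

  module _ {v : ℕ} (ρ : Vec Carrier v) where

    ⟦sumᴾ⟧ : ∀ n (h : Fin n → Polynomial v) {h′ : Fin n → Carrier} →
             (∀ k → ⟦ h k ⟧ ρ ≡ h′ k) → ⟦ sumᴾ n h ⟧ ρ ≡ sumFin R n h′
    ⟦sumᴾ⟧ zero    h eq = ⟦0⟧ᶻ
    ⟦sumᴾ⟧ (suc n) h eq = cong₂ _+_ (eq zero) (⟦sumᴾ⟧ n (λ k → h (suc k)) (λ k → eq (suc k)))

    ⟦identityᴾ⟧ : ∀ {n} (i j : Fin n) → ⟦ identityᴾ i j ⟧ ρ ≡ identity R i j
    ⟦identityᴾ⟧ i j with i ≟ j
    ... | yes _ = ⟦1⟧ᶻ
    ... | no  _ = ⟦0⟧ᶻ

    ⟦evalPolyᴾ⟧ : ∀ {n} (M : SymMatrix v n) {X : Matrix R n} → (∀ i j → ⟦ M i j ⟧ ρ ≡ X i j) →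
                  ∀ qs i j → ⟦ evalPolyᴾ qs M i j ⟧ ρ ≡ evalPoly R (map (λ q → ⟦ q ⟧ ρ) qs) X i j
    ⟦evalPolyᴾ⟧ M M≡X []       i j = ⟦0⟧ᶻ
    ⟦evalPolyᴾ⟧ {n} M M≡X (q ∷ qs) i j =
      cong₂ _+_ (cong (⟦ q ⟧ ρ *_) (⟦identityᴾ⟧ i j))
                (⟦sumᴾ⟧ n _ (λ k → cong₂ _*_ (M≡X i k) (⟦evalPolyᴾ⟧ M M≡X qs k j)))

  SignFree : ∀ {v} → Polynomial v → Set
  SignFree (op _ p q) = SignFree p × SignFree q
  SignFree (var _)    = ⊤
  SignFree _          = ⊥

  signFree-positive : ∀ {v} {ρ : Vec Carrier v} → All (0# <_) ρ →
                      ∀ p → SignFree p → 0# < ⟦ p ⟧ ρ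
  signFree-positive ρ>0 (op [+] p q) (p⁺ , q⁺) = +-pos (signFree-positive ρ>0 p p⁺) (signFree-positive ρ>0 q q⁺)
  signFree-positive ρ>0 (op [*] p q) (p⁺ , q⁺) = *-pos (signFree-positive ρ>0 p p⁺) (signFree-positive ρ>0 q q⁺)
  signFree-positive ρ>0 (var k)      _         = lookup⁺ ρ>0 k

  positive-by-normal-form : ∀ {v} {ρ : Vec Carrier v} → All (0# <_) ρ →
                            ∀ p q → ⟦ p ⟧↓ ρ ≡ ⟦ q ⟧↓ ρ → SignFree q → 0# < ⟦ p ⟧ ρ
  positive-by-normal-form {ρ = ρ} ρ>0 p q p≡q q⁺ =
    subst (0# <_) (sym (prove ρ p q p≡q)) (signFree-positive ρ>0 q q⁺)

  a b c d e f g : Polynomial 7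
  a = var (# 0)
  b = var (# 1)
  c = var (# 2)
  d = var (# 3)
  e = var (# 4)
  f = var (# 5)
  g = var (# 6)

  genericS16 : SymMatrix 7 3
  genericS16 𝟘 𝟘 = :- a
  genericS16 𝟘 𝟙 = b
  genericS16 𝟘 𝟚 = :- c
  genericS16 𝟙 𝟘 = con (0 , 0)
  genericS16 𝟙 𝟙 = d
  genericS16 𝟙 𝟚 = e
  genericS16 𝟚 𝟘 = f
  genericS16 𝟚 𝟙 = con (0 , 0)
  genericS16 𝟚 𝟚 = :- g

  twoC α β : Polynomial 7
  twoC = c :+ c
  α    = twoC :* (a :+ g) :+ b :* e
  β    = twoC :* c :* f :+ (a :+ a) :* c :* g :+ a :* b :* e :+ g :* b :* e

  p : List (Polynomial 7)
  p = β ∷ α ∷ twoC ∷ []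

  p[X] : SymMatrix 7 3
  p[X] = evalPolyᴾ p genericS16

  p[X]-positive : ∀ {ρ : Vec Carrier 7} → All (0# <_) ρ → ∀ i j → 0# < ⟦ p[X] i j ⟧ ρ
  p[X]-positive ρ>0 𝟘 𝟘 = positive-by-normal-form ρ>0 (p[X] 𝟘 𝟘) (g :* b :* e) refl _
  p[X]-positive ρ>0 𝟘 𝟙 = positive-by-normal-form ρ>0 (p[X] 𝟘 𝟙) (b :* (twoC :* g :+ b :* e :+ twoC :* d)) refl _
  p[X]-positive ρ>0 𝟘 𝟚 = positive-by-normal-form ρ>0 (p[X] 𝟘 𝟚) (c :* b :* e) refl _
  p[X]-positive ρ>0 𝟙 𝟘 = positive-by-normal-form ρ>0 (p[X] 𝟙 𝟘) (twoC :* e :* f) refl _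
  p[X]-positive ρ>0 𝟙 𝟙 = positive-by-normal-form ρ>0 (p[X] 𝟙 𝟙) (β :+ α :* d :+ twoC :* d :* d) refl _
  p[X]-positive ρ>0 𝟙 𝟚 = positive-by-normal-form ρ>0 (p[X] 𝟙 𝟚) (e :* (twoC :* a :+ b :* e :+ twoC :* d)) refl _
  p[X]-positive ρ>0 𝟚 𝟘 = positive-by-normal-form ρ>0 (p[X] 𝟚 𝟘) (f :* b :* e) refl _
  p[X]-positive ρ>0 𝟚 𝟙 = positive-by-normal-form ρ>0 (p[X] 𝟚 𝟙) (twoC :* f :* b) refl _
  p[X]-positive ρ>0 𝟚 𝟚 = positive-by-normal-form ρ>0 (p[X] 𝟚 𝟚) (a :* b :* e) refl _

  parameters : Matrix R 3 → Vec Carrier 7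
  parameters X = - X 𝟘 𝟘 ∷ X 𝟘 𝟙 ∷ - X 𝟘 𝟚 ∷ X 𝟙 𝟙 ∷ X 𝟙 𝟚 ∷ X 𝟚 𝟘 ∷ - X 𝟚 𝟚 ∷ []

  parameters-positive : ∀ {X} → InQ R S16 X → All (0# <_) (parameters X)
  parameters-positive X∈Q =
    neg⇒-pos (X∈Q 𝟘 𝟘) ∷ X∈Q 𝟘 𝟙 ∷ neg⇒-pos (X∈Q 𝟘 𝟚) ∷ X∈Q 𝟙 𝟙 ∷ X∈Q 𝟙 𝟚 ∷
    X∈Q 𝟚 𝟘 ∷ neg⇒-pos (X∈Q 𝟚 𝟚) ∷ []

  genericS16-at-parameters : ∀ {X} → InQ R S16 X → ∀ i j → ⟦ genericS16 i j ⟧ (parameters X) ≡ X i j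
  genericS16-at-parameters X∈Q 𝟘 𝟘 = -‿involutive _
  genericS16-at-parameters X∈Q 𝟘 𝟙 = refl
  genericS16-at-parameters X∈Q 𝟘 𝟚 = -‿involutive _
  genericS16-at-parameters X∈Q 𝟙 𝟘 = trans ⟦0⟧ᶻ (sym (X∈Q 𝟙 𝟘))
  genericS16-at-parameters X∈Q 𝟙 𝟙 = refl
  genericS16-at-parameters X∈Q 𝟙 𝟚 = refl
  genericS16-at-parameters X∈Q 𝟚 𝟘 = refl
  genericS16-at-parameters X∈Q 𝟚 𝟙 = trans ⟦0⟧ᶻ (sym (X∈Q 𝟚 𝟙))
  genericS16-at-parameters X∈Q 𝟚 𝟚 = -‿involutive _

  S16-requiresAlgebraicPositivity : RequiresAlgebraicPositivity R S16
  S16-requiresAlgebraicPositivity X X∈Q = map (λ q → ⟦ q ⟧ ρ) p , p[X]>0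
    where
    ρ : Vec Carrier 7
    ρ = parameters X

    p[X]>0 : ∀ i j → 0# < evalPoly R (map (λ q → ⟦ q ⟧ ρ) p) X i j
    p[X]>0 i j = subst (0# <_) (⟦evalPolyᴾ⟧ ρ genericS16 (genericS16-at-parameters X∈Q) p i j)
                               (p[X]-positive (parameters-positive X∈Q) i j)

mainTheorem16 : (R : RealField) → RequiresAlgebraicPositivity R S16
mainTheorem16 = S16-requiresAlgebraicPositivity
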